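{- Let $R$ be a transcendental Dedekind domain, and let $a,b$ be elements algebraic over the fraction field of $R$ such that $(a+b)^2\in R$ and $ab\in R$, and the principal ideals $\langle(a+b)^2\rangle$ and $\langle ab\rangle$ of $R$ are coprime. Then for every odd integer $n\ge1$, the element $P_n(a,b)=\sum_{k=0}^{n-1}a^{n-1-k}b^k$ (which equals $(a^n-b^n)/(a-b)$ when $a\ne b$) lies in $R$, and the principal ideals $\langle P_n(a,b)\rangle$ and $\langle(a+b)^2\rangle$ of $R$ are coprime.
   Context: A Dedekind domain $R$ is called transcendental if it is not a field but contains a field. Two ideals of $R$ are coprime if their sum is $R$ (equivalently, no prime ideal contains both). -}

module Defs where

open import Level using (Level; _⊔_)
open import Data.Nat using (ℕ; zero; suc; _∸_; _≤_)
open import Data.List using (List; []; _∷_; map)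
open import Data.List.Relation.Unary.Any using (Any)
open import Data.Product using (Σ; ∃; ∃-syntax; _×_; _,_)
open import Data.Sum using (_⊎_)
open import Relation.Nullary using (¬_)
open import Algebra.Bundles using (CommutativeRing)
open import Algebra.Morphism.Structures using (module RingMorphisms)

private variable c ℓ c' ℓ' : Level

module _ (R : CommutativeRing c ℓ) where
  open CommutativeRing R

  pow : Carrier → ℕ → Carrier
  pow x zero = 1#
  pow x (suc n) = x * pow x n

  sumBelow : ℕ → (ℕ → Carrier) → Carrier
  sumBelow zero f = 0#
  sumBelow (suc n) f = sumBelow n f + f n

  Pn : ℕ → Carrier → Carrier → Carrier
  Pn n a b = sumBelow n (λ k → pow a (n ∸ 1 ∸ k) * pow b k)

  evalPoly : List Carrier → Carrier → Carrier
  evalPoly [] x = 0#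
  evalPoly (c₀ ∷ cs) x = c₀ + x * evalPoly cs x

  _∣_ : Carrier → Carrier → Set (c ⊔ ℓ)
  y ∣ x = ∃[ q ] (x ≈ y * q)

  IsUnit : Carrier → Set (c ⊔ ℓ)
  IsUnit x = ∃[ y ] (x * y ≈ 1#)

  IsIntegralDomain : Set (c ⊔ ℓ)
  IsIntegralDomain = ¬ (1# ≈ 0#) × (∀ x y → x * y ≈ 0# → x ≈ 0# ⊎ y ≈ 0#)

  IsField : Set (c ⊔ ℓ)
  IsField = IsIntegralDomain × (∀ x → ¬ (x ≈ 0#) → IsUnit x)

  record Ideal : Set (Level.suc (c ⊔ ℓ)) where
    field
      _∈I : Carrier → Set (c ⊔ ℓ)
      resp : ∀ {x y} → x ≈ y → x ∈I → y ∈I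
      zero∈ : 0# ∈I
      +-closed : ∀ {x y} → x ∈I → y ∈I → (x + y) ∈I
      *-closed : ∀ r {x} → x ∈I → (r * x) ∈I
  open Ideal public

  _⊆_ : Ideal → Ideal → Set (c ⊔ ℓ)
  I ⊆ J = ∀ x → (_∈I I x) → (_∈I J x)

  IsPrime : Ideal → Set (c ⊔ ℓ)
  IsPrime P = ¬ (_∈I P 1#) × (∀ x y → _∈I P (x * y) → _∈I P x ⊎ _∈I P y)

  IsMaximal : Ideal → Set (Level.suc (c ⊔ ℓ))
  IsMaximal M = ¬ (_∈I M 1#) × (∀ (J : Ideal) → M ⊆ J → J ⊆ M ⊎ _∈I J 1#)

  IsNoetherian : Set (Level.suc (c ⊔ ℓ))
  IsNoetherian = ∀ (I : ℕ → Ideal) → (∀ n → I n ⊆ I (suc n)) →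
                 ∃[ N ] (∀ m → N ≤ m → I m ⊆ I N)

  DimAtMostOne : Set (Level.suc (c ⊔ ℓ))
  DimAtMostOne = ∀ (P : Ideal) → IsPrime P → (∃[ x ] (_∈I P x × ¬ (x ≈ 0#))) → IsMaximal P

  -- integrally closed in the fraction field: if x/y (y ≠ 0) is a root of a monic
  -- polynomial X^n + c_{n-1} X^{n-1} + ... + c_0 over R, then x/y ∈ R, i.e. y ∣ x.
  -- Cleared of denominators: y^n · f(x/y) = x^n + Σ_{i<n} c_i x^i y^{n-i}.
  IsIntegrallyClosed : Set (c ⊔ ℓ)
  IsIntegrallyClosed = ∀ x y → ¬ (y ≈ 0#) → (n : ℕ) → (cf : ℕ → Carrier) →
    pow x n + sumBelow n (λ i → cf i * pow x i * pow y (n ∸ i)) ≈ 0# → y ∣ x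

  IsDedekindDomain : Set (Level.suc (c ⊔ ℓ))
  IsDedekindDomain = IsIntegralDomain × IsNoetherian × DimAtMostOne × IsIntegrallyClosed

  record Subfield : Set (Level.suc (c ⊔ ℓ)) where
    field
      _∈F : Carrier → Set (c ⊔ ℓ)
      resp : ∀ {x y} → x ≈ y → x ∈F → y ∈F
      zero∈ : 0# ∈F
      one∈ : 1# ∈F
      +-closed : ∀ {x y} → x ∈F → y ∈F → (x + y) ∈F
      neg-closed : ∀ {x} → x ∈F → (- x) ∈F
      *-closed : ∀ {x y} → x ∈F → y ∈F → (x * y) ∈F
      inv-closed : ∀ {x} → x ∈F → ¬ (x ≈ 0#) → ∃[ y ] (y ∈F × x * y ≈ 1#)

  IsTranscendentalDedekind : Set (Level.suc (c ⊔ ℓ))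
  IsTranscendentalDedekind = IsDedekindDomain × ¬ IsField × Subfield

  -- the ideals ⟨x⟩ and ⟨y⟩ are coprime: ⟨x⟩ + ⟨y⟩ = R, i.e. 1 ∈ ⟨x⟩ + ⟨y⟩
  Coprime : Carrier → Carrier → Set (c ⊔ ℓ)
  Coprime x y = ∃[ r ] ∃[ s ] (r * x + s * y ≈ 1#)

IsEmbedding : (R : CommutativeRing c ℓ) (L : CommutativeRing c' ℓ') →
              (CommutativeRing.Carrier R → CommutativeRing.Carrier L) → Set (c ⊔ ℓ ⊔ ℓ')
IsEmbedding R L ι =
  RingMorphisms.IsRingMonomorphism (CommutativeRing.rawRing R) (CommutativeRing.rawRing L) ι

-- a ∈ L is algebraic over Frac(R): it is a root of a nonzero polynomial with
-- coefficients in Frac(R); equivalently (clearing denominators) in R.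
IsAlgebraicOverFrac : (R : CommutativeRing c ℓ) (L : CommutativeRing c' ℓ') →
  (CommutativeRing.Carrier R → CommutativeRing.Carrier L) → CommutativeRing.Carrier L → Set (c ⊔ ℓ ⊔ ℓ')
IsAlgebraicOverFrac R L ι a =
  ∃[ cs ] (Any (λ x → ¬ (x R.≈ R.0#)) cs × evalPoly L (map ι cs) a L.≈ L.0#)
  where module R = CommutativeRing R
        module L = CommutativeRing L

module Submission where

-- Write e = a + b, s = e² and p = ab, so that ι s ≈ e² and ι p ≈ ab in L.
-- The sums P_n = P_n(a,b) satisfy the linear recurrence
--   P_{n+2} = e·P_{n+1} − p·P_n,          P_0 = 0, P_1 = 1,
-- and taking two steps at a time, the odd terms satisfy
--   P_{2m+5} = (e² − 2p)·P_{2m+3} − p²·P_{2m+1},   P_1 = 1, P_3 = e² − p,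
-- whose coefficients s − 2p, p² and initial values 1, s − p all lie in R.
-- So the sequence Q = oddTerms defined in R by this recurrence is mapped by ι onto the
-- odd terms (a ring homomorphism preserves recurrences, and a second-order
-- recurrence is determined by its first two values).  Modulo s the recurrence
-- of Q reads Q_{m+2} ≡ −2p·Q_{m+1} − p²·Q_m, whence Q_m ≡ (−p)^m (mod s);
-- since ⟨p⟩ and ⟨s⟩ are coprime, so are ⟨Q_m⟩ and ⟨s⟩.

open import Level using (Level)
open import Data.Nat.Base as ℕ using (ℕ; zero; suc)
open import Data.Product.Base using (∃-syntax; _×_; _,_; proj₁)
open import Function.Base using (_∘_)
import Relation.Binary.PropositionalEquality as Eq
open import Algebra.Bundles using (CommutativeRing)
open import Algebra.Morphism.Structures using (module RingMorphisms)
open import Defs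

private variable c ℓ c′ ℓ′ : Level

-- A ring solver for an arbitrary commutative ring S, with integer
-- coefficients interpreted through the canonical homomorphism ℤ → S.
-- (Integer coefficients make cancellations such as x − x = 0 computable.)
module IntegerCoefficients (S : CommutativeRing c ℓ) where
  open import Data.Integer.Base as ℤ using (ℤ; +_; -[1+_]; sign; ∣_∣; _◃_; _⊖_)
  import Data.Integer.Properties as ℤₚ
  open import Data.Sign.Base as Sign using (Sign)
  open import Data.Maybe.Base using (Maybe; just; nothing)
  open import Relation.Nullary.Decidable.Core using (yes; no)
  import Algebra.Solver.Ring.AlmostCommutativeRing as ACR

  open CommutativeRing S
  open import Algebra.Properties.Ring ring using (-0#≈0#; -‿involutive; -‿+-comm; -‿distribˡ-*; -‿distribʳ-*)
  open import Algebra.Properties.Semiring.Mult semiring using (×-homo-+; ×1-homo-*) renaming (_×_ to _·_)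
  open import Relation.Binary.Reasoning.Setoid setoid

  fromℤ : ℤ → Carrier
  fromℤ (+ n)    = n · 1#
  fromℤ -[1+ n ] = - (suc n · 1#)

  signed : Sign → Carrier → Carrier
  signed Sign.+ x = x
  signed Sign.- x = - x

  signed-cong : ∀ σ {x y} → x ≈ y → signed σ x ≈ signed σ y
  signed-cong Sign.+ x≈y = x≈y
  signed-cong Sign.- x≈y = -‿cong x≈y

  signed-* : ∀ σ τ x y → signed (σ Sign.* τ) (x * y) ≈ signed σ x * signed τ y
  signed-* Sign.+ Sign.+ x y = refl
  signed-* Sign.+ Sign.- x y = -‿distribʳ-* x y
  signed-* Sign.- Sign.+ x y = -‿distribˡ-* x y
  signed-* Sign.- Sign.- x y = begin
    x * y           ≈⟨ -‿involutive (x * y) ⟨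
    - (- (x * y))   ≈⟨ -‿cong (-‿distribˡ-* x y) ⟩
    - (- x * y)     ≈⟨ -‿distribʳ-* (- x) y ⟩
    - x * - y       ∎

  fromℤ-◃ : ∀ σ n → fromℤ (σ ◃ n) ≈ signed σ (n · 1#)
  fromℤ-◃ Sign.- zero    = sym -0#≈0#
  fromℤ-◃ Sign.+ zero    = refl
  fromℤ-◃ Sign.- (suc n) = refl
  fromℤ-◃ Sign.+ (suc n) = refl

  fromℤ-signed : ∀ i → fromℤ i ≈ signed (sign i) (∣ i ∣ · 1#)
  fromℤ-signed (+ zero)  = refl
  fromℤ-signed (+ suc n) = refl
  fromℤ-signed -[1+ n ]  = refl

  fromℤ-* : ∀ i j → fromℤ (i ℤ.* j) ≈ fromℤ i * fromℤ j
  fromℤ-* i j = begin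
    fromℤ (sign i Sign.* sign j ◃ ∣ i ∣ ℕ.* ∣ j ∣)          ≈⟨ fromℤ-◃ (sign i Sign.* sign j) (∣ i ∣ ℕ.* ∣ j ∣) ⟩
    signed (sign i Sign.* sign j) ((∣ i ∣ ℕ.* ∣ j ∣) · 1#)  ≈⟨ signed-cong (sign i Sign.* sign j) (×1-homo-* ∣ i ∣ ∣ j ∣) ⟩
    signed (sign i Sign.* sign j) (∣ i ∣ · 1# * ∣ j ∣ · 1#) ≈⟨ signed-* (sign i) (sign j) _ _ ⟩
    signed (sign i) (∣ i ∣ · 1#) * signed (sign j) (∣ j ∣ · 1#) ≈⟨ *-cong (fromℤ-signed i) (fromℤ-signed j) ⟨
    fromℤ i * fromℤ j                                       ∎

  1+x-[1+y] : ∀ x y → (1# + x) - (1# + y) ≈ x - y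
  1+x-[1+y] x y = begin
    (1# + x) + - (1# + y)     ≈⟨ +-congˡ (-‿+-comm 1# y) ⟨
    (1# + x) + (- 1# + - y)   ≈⟨ +-congʳ (+-comm 1# x) ⟩
    (x + 1#) + (- 1# + - y)   ≈⟨ +-assoc x 1# _ ⟩
    x + (1# + (- 1# + - y))   ≈⟨ +-congˡ (+-assoc 1# (- 1#) (- y)) ⟨
    x + ((1# - 1#) + - y)     ≈⟨ +-congˡ (+-congʳ (-‿inverseʳ 1#)) ⟩
    x + (0# + - y)            ≈⟨ +-congˡ (+-identityˡ (- y)) ⟩
    x - y                     ∎

  fromℤ-⊖ : ∀ m n → fromℤ (m ⊖ n) ≈ m · 1# - n · 1#
  fromℤ-⊖ zero    zero    = sym (trans (+-identityˡ _) -0#≈0#)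
  fromℤ-⊖ zero    (suc n) = sym (+-identityˡ _)
  fromℤ-⊖ (suc m) zero    = sym (trans (+-congˡ -0#≈0#) (+-identityʳ _))
  fromℤ-⊖ (suc m) (suc n) = begin
    fromℤ (suc m ⊖ suc n)         ≡⟨ Eq.cong fromℤ (ℤₚ.[1+m]⊖[1+n]≡m⊖n m n) ⟩
    fromℤ (m ⊖ n)                 ≈⟨ fromℤ-⊖ m n ⟩
    m · 1# - n · 1#               ≈⟨ 1+x-[1+y] _ _ ⟨
    suc m · 1# - suc n · 1#       ∎

  fromℤ-+ : ∀ i j → fromℤ (i ℤ.+ j) ≈ fromℤ i + fromℤ j
  fromℤ-+ (+ m)    (+ n)    = ×-homo-+ 1# m n
  fromℤ-+ (+ m)    -[1+ n ] = fromℤ-⊖ m (suc n)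
  fromℤ-+ -[1+ m ] (+ n)    = trans (fromℤ-⊖ n (suc m)) (+-comm _ _)
  fromℤ-+ -[1+ m ] -[1+ n ] = begin
    - (1# + (suc m ℕ.+ n) · 1#)   ≡⟨ Eq.cong (λ k → - (suc k · 1#)) (Eq.sym (+-suc m n)) ⟩
    - ((suc m ℕ.+ suc n) · 1#)    ≈⟨ -‿cong (×-homo-+ 1# (suc m) (suc n)) ⟩
    - (suc m · 1# + suc n · 1#)   ≈⟨ -‿+-comm _ _ ⟨
    fromℤ -[1+ m ] + fromℤ -[1+ n ] ∎
    where open import Data.Nat.Properties using (+-suc)

  fromℤ-neg : ∀ i → fromℤ (ℤ.- i) ≈ - fromℤ i
  fromℤ-neg (+ zero)  = sym -0#≈0#
  fromℤ-neg (+ suc n) = refl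
  fromℤ-neg -[1+ n ]  = sym (-‿involutive _)

  fromℤ-homomorphism : CommutativeRing.rawRing ℤₚ.+-*-commutativeRing ACR.-Raw-AlmostCommutative⟶ ACR.fromCommutativeRing S
  fromℤ-homomorphism = record
    { ⟦_⟧ = fromℤ ; +-homo = fromℤ-+ ; *-homo = fromℤ-* ; -‿homo = fromℤ-neg
    ; 0-homo = refl ; 1-homo = +-identityʳ 1# }

  -- Equality of integer coefficients is decidable, which lets the solver prune zero terms.
  coefficient-equality? : ∀ i j → Maybe (fromℤ i ≈ fromℤ j)
  coefficient-equality? i j with i ℤₚ.≟ j
  ... | yes Eq.refl = just refl
  ... | no _       = nothing

  open import Algebra.Solver.Ring _ _ fromℤ-homomorphism coefficient-equality? public

module LinearRecurrence (S : CommutativeRing c ℓ) where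
  open CommutativeRing S
  open import Relation.Binary.Reasoning.Setoid setoid
  open IntegerCoefficients S using (solve; _:=_; _:+_; _:-_; _:*_)

  Recurrence : Carrier → Carrier → (ℕ → Carrier) → Set ℓ
  Recurrence e p x = ∀ n → x (suc (suc n)) ≈ e * x (suc n) - p * x n

  recurrenceSequence : (e p x₀ x₁ : Carrier) → ℕ → Carrier
  recurrenceSequence e p x₀ x₁ zero          = x₀
  recurrenceSequence e p x₀ x₁ (suc zero)    = x₁
  recurrenceSequence e p x₀ x₁ (suc (suc n)) =
    e * recurrenceSequence e p x₀ x₁ (suc n) - p * recurrenceSequence e p x₀ x₁ n

  recurrenceSequence-recurrence : ∀ e p x₀ x₁ → Recurrence e p (recurrenceSequence e p x₀ x₁)
  recurrenceSequence-recurrence e p x₀ x₁ n = refl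

  recurrence-cong : ∀ {e e′ p p′ x} → e ≈ e′ → p ≈ p′ → Recurrence e p x → Recurrence e′ p′ x
  recurrence-cong e≈e′ p≈p′ rec n = trans (rec n) (+-cong (*-congʳ e≈e′) (-‿cong (*-congʳ p≈p′)))

  recurrence-unique : ∀ {e p x y} → Recurrence e p x → Recurrence e p y →
                      x 0 ≈ y 0 → x 1 ≈ y 1 → ∀ n → x n ≈ y n
  recurrence-unique {e} {p} {x} {y} recx recy x₀≈y₀ x₁≈y₁ n = proj₁ (consecutive n)
    where
    consecutive : ∀ n → x n ≈ y n × x (suc n) ≈ y (suc n)
    consecutive zero    = x₀≈y₀ , x₁≈y₁
    consecutive (suc n) with consecutive n
    ... | xₙ≈yₙ , xₙ₊₁≈yₙ₊₁ = xₙ₊₁≈yₙ₊₁ , (begin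
      x (suc (suc n))              ≈⟨ recx n ⟩
      e * x (suc n) - p * x n      ≈⟨ +-cong (*-congˡ xₙ₊₁≈yₙ₊₁) (-‿cong (*-congˡ xₙ≈yₙ)) ⟩
      e * y (suc n) - p * y n      ≈⟨ recy n ⟨
      y (suc (suc n))              ∎)

  recurrence-twoSteps : ∀ {e p x} → Recurrence e p x → ∀ n →
    x (4 ℕ.+ n) ≈ (e * e - (p + p)) * x (2 ℕ.+ n) - (p * p) * x n
  recurrence-twoSteps {e} {p} {x} rec n = begin
    x (4 ℕ.+ n)                               ≈⟨ rec (2 ℕ.+ n) ⟩
    e * x (3 ℕ.+ n) - p * x₂                  ≈⟨ +-congʳ (*-congˡ (rec (1 ℕ.+ n))) ⟩
    e * (e * x₂ - p * x₁) - p * x₂            ≈⟨ +-cong (*-congˡ (+-congʳ (*-congˡ (rec n)))) (-‿cong (*-congˡ (rec n))) ⟩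
    e * (e * x₂′ - p * x₁) - p * x₂′          ≈⟨ solve 4 (λ e p x₀ x₁ →
                                                   e :* (e :* (e :* x₁ :- p :* x₀) :- p :* x₁) :- p :* (e :* x₁ :- p :* x₀)
                                                   := (e :* e :- (p :+ p)) :* (e :* x₁ :- p :* x₀) :- (p :* p) :* x₀)
                                                   refl e p x₀ x₁ ⟩
    (e * e - (p + p)) * x₂′ - (p * p) * x₀    ≈⟨ +-congʳ (*-congˡ (rec n)) ⟨
    (e * e - (p + p)) * x₂ - (p * p) * x₀     ∎
    where
    x₀ = x n
    x₁ = x (1 ℕ.+ n)
    x₂ = x (2 ℕ.+ n)
    x₂′ = e * x₁ - p * x₀

  recurrence-bisect : ∀ {e p x} → Recurrence e p x → ∀ k →
    Recurrence (e * e - (p + p)) (p * p) (λ m → x (k ℕ.+ 2 ℕ.* m))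
  recurrence-bisect {e} {p} {x} rec k m = begin
    x (k ℕ.+ 2 ℕ.* suc (suc m))                     ≡⟨ Eq.cong x (two-more (suc m)) ⟩
    x (2 ℕ.+ (k ℕ.+ 2 ℕ.* suc m))                   ≡⟨ Eq.cong (λ i → x (2 ℕ.+ i)) (two-more m) ⟩
    x (4 ℕ.+ i)                                     ≈⟨ recurrence-twoSteps rec i ⟩
    (e * e - (p + p)) * x (2 ℕ.+ i) - (p * p) * x i ≡⟨ Eq.cong (λ j → (e * e - (p + p)) * x j - (p * p) * x i) (two-more m) ⟨
    (e * e - (p + p)) * x (k ℕ.+ 2 ℕ.* suc m) - (p * p) * x i ∎
    where
    open import Data.Nat.Properties using (+-suc; *-suc)
    i = k ℕ.+ 2 ℕ.* m
    two-more : ∀ m → k ℕ.+ 2 ℕ.* suc m Eq.≡ 2 ℕ.+ (k ℕ.+ 2 ℕ.* m)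
    two-more m = Eq.trans (Eq.cong (k ℕ.+_) (*-suc 2 m))
                   (Eq.trans (+-suc k (1 ℕ.+ 2 ℕ.* m)) (Eq.cong suc (+-suc k (2 ℕ.* m))))

module RecurrenceTransport (R : CommutativeRing c ℓ) (L : CommutativeRing c′ ℓ′)
  (ι : CommutativeRing.Carrier R → CommutativeRing.Carrier L)
  (hom : RingMorphisms.IsRingHomomorphism (CommutativeRing.rawRing R) (CommutativeRing.rawRing L) ι) where
  private module R = CommutativeRing R
  open CommutativeRing L
  open RingMorphisms.IsRingHomomorphism hom
  open import Relation.Binary.Reasoning.Setoid setoid
  open LinearRecurrence R using () renaming (Recurrence to Recurrenceᴿ)
  open LinearRecurrence L using () renaming (Recurrence to Recurrenceᴸ)

  sub-homo : ∀ x y → ι (x R.- y) ≈ ι x - ι y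
  sub-homo x y = trans (+-homo x (R.- y)) (+-congˡ (-‿homo y))

  recurrence-map : ∀ {e p x} → Recurrenceᴿ e p x → Recurrenceᴸ (ι e) (ι p) (ι ∘ x)
  recurrence-map {e} {p} {x} rec n = begin
    ι (x (suc (suc n)))                        ≈⟨ ⟦⟧-cong (rec n) ⟩
    ι (e R.* x (suc n) R.- p R.* x n)          ≈⟨ sub-homo _ _ ⟩
    ι (e R.* x (suc n)) - ι (p R.* x n)        ≈⟨ +-cong (*-homo _ _) (-‿cong (*-homo _ _)) ⟩
    ι e * ι (x (suc n)) - ι p * ι (x n)        ∎

module GeometricSums (S : CommutativeRing c ℓ) where
  open CommutativeRing S
  open import Relation.Binary.Reasoning.Setoid setoid
  open IntegerCoefficients S using (solve; _:=_; _:+_; _:-_; _:*_)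
  open LinearRecurrence S using (Recurrence)
  open import Data.Nat.Base using (_∸_; _<_; s≤s)
  open import Data.Nat.Properties using (+-∸-assoc; n∸n≡0; m<n⇒m<1+n; n<1+n)

  sumBelow-cong : ∀ n {f g : ℕ → Carrier} → (∀ k → k < n → f k ≈ g k) → sumBelow S n f ≈ sumBelow S n g
  sumBelow-cong zero    f≈g = refl
  sumBelow-cong (suc n) f≈g = +-cong (sumBelow-cong n (λ k k<n → f≈g k (m<n⇒m<1+n k<n))) (f≈g n (n<1+n n))

  sumBelow-*ˡ : ∀ n x (f : ℕ → Carrier) → sumBelow S n (λ k → x * f k) ≈ x * sumBelow S n f
  sumBelow-*ˡ zero    x f = sym (zeroʳ x)
  sumBelow-*ˡ (suc n) x f = trans (+-congʳ (sumBelow-*ˡ n x f)) (sym (distribˡ x _ _))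

  Pn-suc : ∀ n a b → Pn S (suc n) a b ≈ a * Pn S n a b + pow S b n
  Pn-suc n a b = +-cong
    (begin
      sumBelow S n (λ k → pow S a (n ∸ k) * pow S b k)            ≈⟨ sumBelow-cong n term ⟩
      sumBelow S n (λ k → a * (pow S a (n ∸ 1 ∸ k) * pow S b k))  ≈⟨ sumBelow-*ˡ n a _ ⟩
      a * Pn S n a b                                              ∎)
    (trans (*-congʳ (reflexive (Eq.cong (pow S a) (n∸n≡0 n)))) (*-identityˡ _))
    where
    exponent : ∀ {n} k → k < n → n ∸ k Eq.≡ suc (n ∸ 1 ∸ k)
    exponent {suc n} k (s≤s k≤n) = +-∸-assoc 1 k≤n
    term : ∀ k → k < n → pow S a (n ∸ k) * pow S b k ≈ a * (pow S a (n ∸ 1 ∸ k) * pow S b k)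
    term k k<n = trans (*-congʳ (reflexive (Eq.cong (pow S a) (exponent k k<n)))) (*-assoc _ _ _)

  Pn-recurrence : ∀ a b → Recurrence (a + b) (a * b) (λ n → Pn S n a b)
  Pn-recurrence a b n = begin
    Pn S (suc (suc n)) a b                            ≈⟨ Pn-suc (suc n) a b ⟩
    a * Pn S (suc n) a b + b * pow S b n              ≈⟨ +-congʳ (*-congˡ (Pn-suc n a b)) ⟩
    a * (a * Pn S n a b + pow S b n) + b * pow S b n  ≈⟨ solve 4 (λ a b x y →
                                                          a :* (a :* x :+ y) :+ b :* y := (a :+ b) :* (a :* x :+ y) :- (a :* b) :* x)
                                                          refl a b (Pn S n a b) (pow S b n) ⟩
    (a + b) * (a * Pn S n a b + pow S b n) - (a * b) * Pn S n a b ≈⟨ +-congʳ (*-congˡ (Pn-suc n a b)) ⟨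
    (a + b) * Pn S (suc n) a b - (a * b) * Pn S n a b ∎

  Pn-one : ∀ a b → Pn S 1 a b ≈ 1#
  Pn-one a b = trans (+-identityˡ _) (*-identityˡ 1#)

  Pn-two : ∀ a b → Pn S 2 a b ≈ a + b
  Pn-two a b = begin
    Pn S 2 a b               ≈⟨ Pn-suc 1 a b ⟩
    a * Pn S 1 a b + b * 1#  ≈⟨ +-cong (*-congˡ (Pn-one a b)) (*-identityʳ b) ⟩
    a * 1# + b               ≈⟨ +-congʳ (*-identityʳ a) ⟩
    a + b                    ∎

  Pn-three : ∀ a b → Pn S 3 a b ≈ (a + b) * (a + b) - a * b
  Pn-three a b = begin
    Pn S 3 a b                                  ≈⟨ Pn-recurrence a b 1 ⟩
    (a + b) * Pn S 2 a b - (a * b) * Pn S 1 a b ≈⟨ +-cong (*-congˡ (Pn-two a b)) (-‿cong (*-congˡ (Pn-one a b))) ⟩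
    (a + b) * (a + b) - (a * b) * 1#            ≈⟨ +-congˡ (-‿cong (*-identityʳ _)) ⟩
    (a + b) * (a + b) - a * b                   ∎

module Coprimality (S : CommutativeRing c ℓ) where
  open CommutativeRing S
  open import Relation.Binary.Reasoning.Setoid setoid
  open IntegerCoefficients S using (solve; _:=_; _:+_; _:-_; _:*_; :-_)
  open LinearRecurrence S using (Recurrence)

  infix 4 _≡_mod_
  _≡_mod_ : Carrier → Carrier → Carrier → Set (c Level.⊔ ℓ)
  x ≡ y mod z = ∃[ u ] (x ≈ y + u * z)

  coprime-swap : ∀ {x z} → Coprime S x z → Coprime S z x
  coprime-swap (r , t , rx+tz≈1) = t , r , trans (+-comm _ _) rx+tz≈1

  coprime-neg : ∀ {x z} → Coprime S x z → Coprime S (- x) z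
  coprime-neg {x} (r , t , rx+tz≈1) =
    - r , t , trans (+-congʳ (solve 2 (λ r x → (:- r) :* (:- x) := r :* x) refl r x)) rx+tz≈1

  coprime-one : ∀ z → Coprime S 1# z
  coprime-one z = 1# , 0# , trans (+-cong (*-identityˡ 1#) (zeroˡ z)) (+-identityʳ 1#)

  -- ⟨x⟩ and ⟨y⟩ both coprime to ⟨z⟩: multiply the two Bézout identities.
  coprime-* : ∀ {x y z} → Coprime S x z → Coprime S y z → Coprime S (x * y) z
  coprime-* {x} {y} {z} (r , t , rx+tz≈1) (r′ , t′ , r′y+t′z≈1) =
    r * r′ , r * x * t′ + t * r′ * y + t * t′ * z , (begin
      (r * r′) * (x * y) + (r * x * t′ + t * r′ * y + t * t′ * z) * z
        ≈⟨ solve 7 (λ r t r′ t′ x y z →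
             (r :* r′) :* (x :* y) :+ (r :* x :* t′ :+ t :* r′ :* y :+ t :* t′ :* z) :* z
             := (r :* x :+ t :* z) :* (r′ :* y :+ t′ :* z)) refl r t r′ t′ x y z ⟩
      (r * x + t * z) * (r′ * y + t′ * z)    ≈⟨ *-cong rx+tz≈1 r′y+t′z≈1 ⟩
      1# * 1#                                ≈⟨ *-identityˡ 1# ⟩
      1#                                     ∎)

  coprime-pow : ∀ {x z} m → Coprime S x z → Coprime S (pow S x m) z
  coprime-pow {z = z} zero    _   = coprime-one z
  coprime-pow         (suc m) x⊥z = coprime-* x⊥z (coprime-pow m x⊥z)

  coprime-mod : ∀ {x y z} → x ≡ y mod z → Coprime S y z → Coprime S x z
  coprime-mod {x} {y} {z} (u , x≈y+uz) (r , t , ry+tz≈1) = r , t - r * u , (begin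
    r * x + (t - r * u) * z         ≈⟨ +-congʳ (*-congˡ x≈y+uz) ⟩
    r * (y + u * z) + (t - r * u) * z
      ≈⟨ solve 5 (λ r t u y z → r :* (y :+ u :* z) :+ (t :- r :* u) :* z := r :* y :+ t :* z) refl r t u y z ⟩
    r * y + t * z                   ≈⟨ ry+tz≈1 ⟩
    1#                              ∎)

  -- Modulo s, the recurrence with coefficients s − 2p and p² becomes
  -- x(m+2) ≡ −2p·x(m+1) − p²·x(m), whose solution from 1, −p is (−p)^m.
  powers-mod : ∀ {s p x} → Recurrence (s - (p + p)) (p * p) x →
    x 0 ≡ pow S (- p) 0 mod s → x 1 ≡ pow S (- p) 1 mod s → ∀ m → x m ≡ pow S (- p) m mod s
  powers-mod {s} {p} {x} rec x₀≡ x₁≡ m = proj₁ (consecutive m)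
    where
    consecutive : ∀ m → x m ≡ pow S (- p) m mod s × x (suc m) ≡ pow S (- p) (suc m) mod s
    consecutive zero    = x₀≡ , x₁≡
    consecutive (suc m) with consecutive m
    ... | (u , xₘ≈) , (u′ , xₘ₊₁≈) = (u′ , xₘ₊₁≈) , (_ , (begin
      x (suc (suc m))                                ≈⟨ rec m ⟩
      (s - (p + p)) * x (suc m) - (p * p) * x m      ≈⟨ +-cong (*-congˡ xₘ₊₁≈) (-‿cong (*-congˡ xₘ≈)) ⟩
      (s - (p + p)) * (- p * q + u′ * s) - (p * p) * (q + u * s)
        ≈⟨ solve 5 (λ s p q u u′ →
             (s :- (p :+ p)) :* (:- p :* q :+ u′ :* s) :- (p :* p) :* (q :+ u :* s)
             := :- p :* (:- p :* q) :+ (:- p :* q :+ (s :- (p :+ p)) :* u′ :- (p :* p) :* u) :* s)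
             refl s p q u u′ ⟩
      - p * (- p * q) + (- p * q + (s - (p + p)) * u′ - (p * p) * u) * s ∎))
      where q = pow S (- p) m

oddTerms : (R : CommutativeRing c ℓ) (s p : CommutativeRing.Carrier R) → ℕ → CommutativeRing.Carrier R
oddTerms R s p = recurrenceSequence (s - (p + p)) (p * p) 1# (s - p)
  where open CommutativeRing R
        open LinearRecurrence R using (recurrenceSequence)

-- ⟨oddTerms m⟩ is coprime to ⟨s⟩, because oddTerms m ≡ (−p)^m modulo s.
oddTerms-coprime : (R : CommutativeRing c ℓ) (s p : CommutativeRing.Carrier R) →
  Coprime R s p → ∀ m → Coprime R (oddTerms R s p m) s
oddTerms-coprime R s p s⊥p m = coprime-mod
  (powers-mod (recurrenceSequence-recurrence _ _ _ _) initial₀ initial₁ m)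
  (coprime-pow m (coprime-neg (coprime-swap s⊥p)))
  where
  open CommutativeRing R
  open LinearRecurrence R using (recurrenceSequence-recurrence)
  open Coprimality R
  initial₀ : 1# ≡ 1# mod s
  initial₀ = 0# , sym (trans (+-congˡ (zeroˡ s)) (+-identityʳ 1#))
  initial₁ : s - p ≡ - p * 1# mod s
  initial₁ = 1# , trans (+-comm s (- p)) (+-cong (sym (*-identityʳ (- p))) (sym (*-identityˡ s)))

-- Under a ring homomorphism ι with ι s ≈ (a+b)² and ι p ≈ ab, the odd terms
-- are mapped onto P_{2m+1}(a,b): both sequences satisfy the same recurrence
-- in L and agree at m = 0, 1.
module OddTermsImage (R : CommutativeRing c ℓ) (L : CommutativeRing c′ ℓ′)
  (ι : CommutativeRing.Carrier R → CommutativeRing.Carrier L)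
  (hom : RingMorphisms.IsRingHomomorphism (CommutativeRing.rawRing R) (CommutativeRing.rawRing L) ι) where
  private module R = CommutativeRing R
  open CommutativeRing L
  open RingMorphisms.IsRingHomomorphism hom
  open RecurrenceTransport R L ι hom
  open LinearRecurrence L
  open GeometricSums L using (Pn-recurrence; Pn-one; Pn-three)

  oddTerms-image : ∀ a b s p → ι s ≈ (a + b) * (a + b) → ι p ≈ a * b →
    ∀ m → ι (oddTerms R s p m) ≈ Pn L (suc (2 ℕ.* m)) a b
  oddTerms-image a b s p ιs ιp = recurrence-unique image-recurrence odd-recurrence initial₀ initial₁
    where
    odd-recurrence : Recurrence ((a + b) * (a + b) - (a * b + a * b)) ((a * b) * (a * b)) (λ m → Pn L (suc (2 ℕ.* m)) a b)
    odd-recurrence = recurrence-bisect (Pn-recurrence a b) 1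
    image-recurrence : Recurrence ((a + b) * (a + b) - (a * b + a * b)) ((a * b) * (a * b)) (ι ∘ oddTerms R s p)
    image-recurrence = recurrence-cong
      (trans (sub-homo _ _) (+-cong ιs (-‿cong (trans (+-homo p p) (+-cong ιp ιp)))))
      (trans (*-homo p p) (*-cong ιp ιp))
      (recurrence-map (LinearRecurrence.recurrenceSequence-recurrence R _ _ _ _))
    initial₀ : ι R.1# ≈ Pn L 1 a b
    initial₀ = trans 1#-homo (sym (Pn-one a b))
    initial₁ : ι (s R.- p) ≈ Pn L 3 a b
    initial₁ = trans (sub-homo s p) (trans (+-cong ιs (-‿cong ιp)) (sym (Pn-three a b)))

-- The theorem: q = oddTerms m is the required element of R.  (Multiplication
-- of naturals is opened only here, since ring multiplication is also _*_.)
open import Data.Nat.Base using (_*_)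

lemma2p8 : ∀ {c ℓ c' ℓ'} (R : CommutativeRing c ℓ) (L : CommutativeRing c' ℓ') → IsTranscendentalDedekind R → IsField L → (ι : CommutativeRing.Carrier R → CommutativeRing.Carrier L) → IsEmbedding R L ι → (a b : CommutativeRing.Carrier L) → IsAlgebraicOverFrac R L ι a → IsAlgebraicOverFrac R L ι b → (s p : CommutativeRing.Carrier R) → CommutativeRing._≈_ L (ι s) (CommutativeRing._*_ L (CommutativeRing._+_ L a b) (CommutativeRing._+_ L a b)) → CommutativeRing._≈_ L (ι p) (CommutativeRing._*_ L a b) → Coprime R s p → (m : ℕ) → ∃[ q ] (CommutativeRing._≈_ L (ι q) (Pn L (suc (2 * m)) a b) × Coprime R q s)
lemma2p8 R L _ _ ι embedding a b _ _ s p ιs ιp s⊥p m =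
  oddTerms R s p m , oddTerms-image a b s p ιs ιp m , oddTerms-coprime R s p s⊥p m
  where
  open RingMorphisms.IsRingMonomorphism embedding using (isRingHomomorphism)
  open OddTermsImage R L ι isRingHomomorphism using (oddTerms-image)
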